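{- For all $n\geq0$, \[ j_{2n}(213)=j_{2n}(312)=\frac{1}{2n+1}\binom{3n}{n}\quad\text{and}\quad j_{2n+1}(213)=j_{2n+1}(312)=\frac{1}{2n+1}\binom{3n+1}{n+1}. \]
   Context: A permutation of a finite set $S$ of positive integers is a word in which each element of $S$ appears exactly once; $\mathfrak{S}_n$ is the set of permutations of $\{1,\dots,n\}$. For a permutation $\pi$ and a letter $x$ of $\pi$, $\rho_\pi(x)$ is the maximal consecutive subword of $\pi$ consisting of the letters immediately to the right of $x$ that are all larger than $x$. $\pi$ is Jacobi if $|\rho_\pi(x)|$ is even for all letters $x$. The standardization of a word with distinct letters of length $m$ is the permutation in $\mathfrak{S}_m$ obtained by replacing its $i$th smallest letter by $i$. A permutation $\pi$ avoids $\sigma$ if no (not necessarily consecutive) subword of $\pi$ has standardization $\sigma$. For a set $\Pi$ of patterns, $j_n(\Pi)$ is the number of Jacobi permutations in $\mathfrak{S}_n$ avoiding every pattern in $\Pi$; $j_n(\sigma)=j_n(\{\sigma\})$. -}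

module Defs where

open import Data.Nat using (ℕ; zero; suc; _+_; _<ᵇ_; _≡ᵇ_)
open import Data.Nat.Properties using ()
open import Data.Bool using (Bool; true; false; _∧_; not; if_then_else_)
open import Data.List using (List; []; _∷_; map; concatMap; filter; length; applyUpTo)
open import Data.Bool.ListAction using (all; any)
open import Relation.Binary.PropositionalEquality using (_≡_)

evenᵇ : ℕ → Bool
evenᵇ zero = true
evenᵇ (suc n) = not (evenᵇ n)

oneTo : ℕ → List ℕ
oneTo n = applyUpTo suc n

words : List ℕ → ℕ → List (List ℕ)
words as zero = [] ∷ []
words as (suc k) = concatMap (λ a → map (a ∷_) (words as k)) as

occ : ℕ → List ℕ → ℕ
occ x [] = zero
occ x (y ∷ w) = if x ≡ᵇ y then suc (occ x w) else occ x w

isPermOf : ℕ → List ℕ → Bool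
isPermOf n w = (length w ≡ᵇ n) ∧ all (λ i → occ i w ≡ᵇ 1) (oneTo n)
  ∧ all (λ y → any (λ i → y ≡ᵇ i) (oneTo n)) w

perms : ℕ → List (List ℕ)
perms n = filter (λ w → isPermOf n w Data.Bool.≟ true) (words (oneTo n) n)
  where import Data.Bool

-- |ρ_π(x)| where w is the part of π strictly to the right of x:
-- length of the maximal prefix of w whose letters all exceed x
rhoLen : ℕ → List ℕ → ℕ
rhoLen x [] = zero
rhoLen x (y ∷ w) = if x <ᵇ y then suc (rhoLen x w) else zero

isJacobi : List ℕ → Bool
isJacobi [] = true
isJacobi (x ∷ w) = evenᵇ (rhoLen x w) ∧ isJacobi w

subwords : List ℕ → List (List ℕ)
subwords [] = [] ∷ []
subwords (x ∷ w) = map (x ∷_) (subwords w) Data.List.++ subwords w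

below : ℕ → List ℕ → ℕ
below x [] = zero
below x (y ∷ w) = if y <ᵇ x then suc (below x w) else below x w

standardize : List ℕ → List ℕ
standardize w = map (λ x → suc (below x w)) w

listEq : List ℕ → List ℕ → Bool
listEq [] [] = true
listEq (x ∷ u) (y ∷ v) = (x ≡ᵇ y) ∧ listEq u v
listEq _ _ = false

contains : List ℕ → List ℕ → Bool
contains π σ = any (λ s → listEq (standardize s) σ) (subwords π)

good : List (List ℕ) → List ℕ → Bool
good Π π = isJacobi π ∧ all (λ σ → not (contains π σ)) Π

jSet : List (List ℕ) → ℕ → ℕ
jSet Π n = length (filter (λ π → good Π π Data.Bool.≟ true) (perms n))
  where import Data.Bool

j : List ℕ → ℕ → ℕ
j σ n = jSet (σ ∷ []) n

p213 : List ℕ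
p213 = 2 ∷ 1 ∷ 3 ∷ []

p312 : List ℕ
p312 = 3 ∷ 1 ∷ 2 ∷ []

-- Write a Jacobi permutation π of consecutive integers as π = α x β around its least letter x.
-- Then ρ(x) = β, so |β| is even, and the run ρ(y) of every letter y of α stops at x, so π is
-- Jacobi iff α and β are and |β| is even. Avoiding 312 forces every letter of α below every
-- letter of β (otherwise y x z is a 312), avoiding 213 forces the opposite, and then π avoids
-- the pattern iff α and β do. So for both patterns the counts satisfy a(0) = 1 and
-- a(n + 1) = Σ a(k)·a(m) over k + m = n with m even. Let R(p, r) be the coefficient of xᵖ in
-- B(x)ʳ, where B = 1 + x·B³. Then Bʳ⁺ˢ = Bʳ·Bˢ shows a(2p) = R(p, 1) and a(2p + 1) = R(p, 2),
-- and the closed form R(p, r) = r/(3p+r) · C(3p+r, p) turns these into binomial coefficients.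
module Submission where

open import Defs
open import Data.Bool using (true; false; T; not; _∧_; if_then_else_)
import Data.Bool as Bool
open import Data.Bool.Properties using (T-≡; T-∧; ∧-assoc; not-involutive)
open import Data.Bool.ListAction using (any)
open import Data.Nat using (ℕ; zero; suc; _+_; _*_; _∸_; _≤_; _<_; z≤n; s≤s; z<s; s<s; _<ᵇ_; _≡ᵇ_; _≟_; _<?_)
open import Data.Nat.Properties
open import Algebra.Properties.CommutativeSemigroup +-commutativeSemigroup using (interchange)
open import Algebra.Properties.CommutativeSemigroup *-commutativeSemigroup using (x∙yz≈y∙xz)
open import Data.Nat.Combinatorics using (_C_; nCk+nC[k+1]≡[n+1]C[k+1]; nC1≡n)
open import Data.Nat.ListAction using (sum)
open import Data.Nat.Tactic.RingSolver using (solve-∀)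
open import Data.List using (List; []; _∷_; _++_; map; length; concatMap; cartesianProductWith; filter; applyUpTo)
open import Data.List.Properties
  using (length-++; length-map; length-applyUpTo; ∷-injective; ∷-injectiveˡ; ∷-injectiveʳ; map-∘; map-cong-local)
open import Data.List.Membership.Propositional using (_∈_; _∉_; find; lose)
open import Data.List.Membership.Propositional.Properties
open import Data.List.Relation.Unary.Any using (here; there)
open import Data.List.Relation.Unary.Any.Properties using (any⁺; any⁻)
open import Data.List.Relation.Unary.All using (All; []; _∷_; lookup; tabulate)
open import Data.List.Relation.Unary.All.Properties using (all⁺; all⁻; anti-mono)
open import Data.List.Relation.Unary.Unique.Propositional using (Unique; []; _∷_)
import Data.List.Relation.Unary.Unique.Propositional.Properties as Unique
open import Data.List.Relation.Binary.Disjoint.Propositional using (Disjoint)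
open import Data.List.Relation.Binary.Subset.Propositional using (_⊆_)
open import Data.List.Relation.Binary.Sublist.Propositional using ([]; _∷_; _∷ʳ_; ⊆-refl; ⊆-trans; from∈)
  renaming (_⊆_ to _⊑_)
import Data.List.Relation.Binary.Sublist.Propositional as Sublist
open import Data.List.Relation.Binary.Sublist.Propositional.Properties using (++⁺; ++⁺ˡ; ++⁺ʳ)
open import Data.Product using (_×_; _,_; proj₁; proj₂; ∃; ∃₂; map₁; map₂; swap)
open import Data.Sum using (_⊎_; inj₁; inj₂; [_,_]′)
open import Function using (_∘_)
open import Function.Bundles using (Equivalence; _⇔_; mk⇔)
open import Relation.Nullary using (¬_; contradiction; Dec; yes; no)
open import Relation.Binary.PropositionalEquality

open Equivalence using (to; from)

[1+n]C[1+k]≡nCk+nC[1+k] : ∀ n k → suc n C suc k ≡ n C k + n C suc k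
[1+n]C[1+k]≡nCk+nC[1+k] n k = sym (nCk+nC[k+1]≡[n+1]C[k+1] n k)

[1+k]*[1+n]C[1+k]≡[1+n]*nCk : ∀ n k → suc k * (suc n C suc k) ≡ suc n * (n C k)
[1+k]*[1+n]C[1+k]≡[1+n]*nCk zero zero = refl
[1+k]*[1+n]C[1+k]≡[1+n]*nCk zero (suc k) = *-zeroʳ (suc (suc k))
[1+k]*[1+n]C[1+k]≡[1+n]*nCk (suc n) zero = begin
  1 * (suc (suc n) C 1)  ≡⟨ *-identityˡ _ ⟩
  suc (suc n) C 1        ≡⟨ nC1≡n (suc (suc n)) ⟩
  suc (suc n)            ≡⟨ *-identityʳ (suc (suc n)) ⟨
  suc (suc n) * 1        ∎
  where open ≡-Reasoning
[1+k]*[1+n]C[1+k]≡[1+n]*nCk (suc n) (suc k) = begin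
  suc (suc k) * (suc (suc n) C suc (suc k))
    ≡⟨ cong (suc (suc k) *_) ([1+n]C[1+k]≡nCk+nC[1+k] (suc n) (suc k)) ⟩
  suc (suc k) * (a + b)
    ≡⟨ expand a b k ⟩
  suc k * a + a + suc (suc k) * b
    ≡⟨ cong₂ (λ u v → u + a + v) ([1+k]*[1+n]C[1+k]≡[1+n]*nCk n k) ([1+k]*[1+n]C[1+k]≡[1+n]*nCk n (suc k)) ⟩
  suc n * (n C k) + a + suc n * (n C suc k)
    ≡⟨ cong (λ u → suc n * (n C k) + u + suc n * (n C suc k)) ([1+n]C[1+k]≡nCk+nC[1+k] n k) ⟩
  suc n * (n C k) + (n C k + n C suc k) + suc n * (n C suc k)
    ≡⟨ collect (n C k) (n C suc k) n ⟩
  suc (suc n) * (n C k + n C suc k)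
    ≡⟨ cong (suc (suc n) *_) ([1+n]C[1+k]≡nCk+nC[1+k] n k) ⟨
  suc (suc n) * (suc n C suc k)
    ∎
  where
  open ≡-Reasoning
  a = suc n C suc k
  b = suc n C suc (suc k)
  expand : ∀ a b k → suc (suc k) * (a + b) ≡ suc k * a + a + suc (suc k) * b
  expand = solve-∀
  collect : ∀ c d n → suc n * c + (c + d) + suc n * d ≡ suc (suc n) * (c + d)
  collect = solve-∀

[1+k]*[k+m]C[1+k]≡m*[k+m]Ck : ∀ k m → suc k * ((k + m) C suc k) ≡ m * ((k + m) C k)
[1+k]*[k+m]C[1+k]≡m*[k+m]Ck k m = +-cancelˡ-≡ (suc k * c) _ _ (begin
  suc k * c + suc k * ((k + m) C suc k)  ≡⟨ *-distribˡ-+ (suc k) c _ ⟨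
  suc k * (c + (k + m) C suc k)          ≡⟨ cong (suc k *_) ([1+n]C[1+k]≡nCk+nC[1+k] (k + m) k) ⟨
  suc k * (suc (k + m) C suc k)          ≡⟨ [1+k]*[1+n]C[1+k]≡[1+n]*nCk (k + m) k ⟩
  suc (k + m) * c                        ≡⟨ *-distribʳ-+ c (suc k) m ⟩
  suc k * c + m * c                      ∎)
  where
  open ≡-Reasoning
  c = (k + m) C k

[1+m]*[1+k+m]Ck≡[1+k+m]*[k+m]Ck : ∀ k m → suc m * (suc (k + m) C k) ≡ suc (k + m) * ((k + m) C k)
[1+m]*[1+k+m]Ck≡[1+k+m]*[k+m]Ck zero m = refl
[1+m]*[1+k+m]Ck≡[1+k+m]*[k+m]Ck (suc k) m = begin
  suc m * (suc (suc k + m) C suc k)  ≡⟨ cong (suc m *_) ([1+n]C[1+k]≡nCk+nC[1+k] (suc (k + m)) k) ⟩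
  suc m * (c + d)                    ≡⟨ *-distribˡ-+ (suc m) c d ⟩
  suc m * c + suc m * d              ≡⟨ cong (_+ suc m * d) ratio ⟨
  suc k * d + suc m * d              ≡⟨ *-distribʳ-+ d (suc k) (suc m) ⟨
  (suc k + suc m) * d                ≡⟨ cong (_* d) (+-suc (suc k) m) ⟩
  suc (suc k + m) * d                ∎
  where
  open ≡-Reasoning
  c = suc (k + m) C k
  d = suc (k + m) C suc k
  ratio : suc k * d ≡ suc m * c
  ratio = subst (λ N → suc k * (N C suc k) ≡ suc m * (N C k)) (+-suc k m) ([1+k]*[k+m]C[1+k]≡m*[k+m]Ck k (suc m))

-- Raney numbers

-- raney n r is the coefficient of xⁿ in B(x)ʳ, where B = 1 + x·B³; the last clause is
-- Bʳ⁺¹ = Bʳ + x·Bʳ⁺³.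
raney : ℕ → ℕ → ℕ
raney zero r = 1
raney (suc n) zero = 0
raney (suc n) (suc r) = raney (suc n) r + raney n (3 + r)

convolution : (ℕ → ℕ) → (ℕ → ℕ) → ℕ → ℕ
convolution f g zero = f 0 * g 0
convolution f g (suc n) = f (suc n) * g 0 + convolution f (g ∘ suc) n

convolution-cong : ∀ {f f′ g g′} → (∀ i → f i ≡ f′ i) → (∀ i → g i ≡ g′ i) →
  ∀ n → convolution f g n ≡ convolution f′ g′ n
convolution-cong f≗f′ g≗g′ zero = cong₂ _*_ (f≗f′ 0) (g≗g′ 0)
convolution-cong f≗f′ g≗g′ (suc n) =
  cong₂ _+_ (cong₂ _*_ (f≗f′ (suc n)) (g≗g′ 0)) (convolution-cong f≗f′ (g≗g′ ∘ suc) n)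

convolution-zeroʳ : ∀ f n → convolution f (λ _ → 0) n ≡ 0
convolution-zeroʳ f zero = *-zeroʳ (f 0)
convolution-zeroʳ f (suc n) = cong₂ _+_ (*-zeroʳ (f (suc n))) (convolution-zeroʳ f n)

convolution-distribˡ-+ : ∀ f g h n → convolution f (λ i → g i + h i) n ≡ convolution f g n + convolution f h n
convolution-distribˡ-+ f g h zero = *-distribˡ-+ (f 0) (g 0) (h 0)
convolution-distribˡ-+ f g h (suc n) = begin
  f (suc n) * (g 0 + h 0) + convolution f (λ i → g (suc i) + h (suc i)) n
    ≡⟨ cong₂ _+_ (*-distribˡ-+ (f (suc n)) (g 0) (h 0)) (convolution-distribˡ-+ f (g ∘ suc) (h ∘ suc) n) ⟩
  (f (suc n) * g 0 + f (suc n) * h 0) + (convolution f (g ∘ suc) n + convolution f (h ∘ suc) n)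
    ≡⟨ interchange (f (suc n) * g 0) _ _ _ ⟩
  convolution f g (suc n) + convolution f h (suc n)
    ∎
  where open ≡-Reasoning

raney-+ : ∀ r s n → raney n (s + r) ≡ convolution (λ i → raney i r) (λ i → raney i s) n
raney-+ r s zero = refl
raney-+ r zero (suc n) = begin
  raney (suc n) r                                          ≡⟨ *-identityʳ _ ⟨
  raney (suc n) r * 1                                      ≡⟨ +-identityʳ _ ⟨
  raney (suc n) r * 1 + 0                                  ≡⟨ cong (raney (suc n) r * 1 +_) (convolution-zeroʳ _ n) ⟨
  convolution (λ i → raney i r) (λ i → raney i 0) (suc n)  ∎
  where open ≡-Reasoning
raney-+ r (suc s) (suc n) = begin
  raney (suc n) (s + r) + raney n (3 + s + r)
    ≡⟨ cong₂ _+_ (raney-+ r s (suc n)) (raney-+ r (3 + s) n) ⟩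
  (f (suc n) * 1 + convolution f (λ i → raney (suc i) s) n) + convolution f (λ i → raney i (3 + s)) n
    ≡⟨ +-assoc (f (suc n) * 1) _ _ ⟩
  f (suc n) * 1 + (convolution f (λ i → raney (suc i) s) n + convolution f (λ i → raney i (3 + s)) n)
    ≡⟨ cong (f (suc n) * 1 +_) (convolution-distribˡ-+ f (λ i → raney (suc i) s) (λ i → raney i (3 + s)) n) ⟨
  convolution f (λ i → raney i (suc s)) (suc n)
    ∎
  where
  open ≡-Reasoning
  f = λ i → raney i r

-- Multiplied by K·(n+1), both sides become K·(K+1)·(r+1)·c by the three hypotheses.
raney-closedForm-step : ∀ n r {x y c d} → let K = 3 * suc n + r in
  K * x ≡ r * d → K * y ≡ (3 + r) * c → suc n * d ≡ (2 * n + 3 + r) * c →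
  suc K * (x + y) ≡ suc r * (c + d)
raney-closedForm-step n r {x} {y} {c} {d} Kx≡rd Ky≡[3+r]c [1+n]d≡[2n+3+r]c =
  *-cancelˡ-≡ _ _ (K * suc n) (begin
    (K * suc n) * (suc K * (x + y))
      ≡⟨ e₁ n r x y ⟩
    suc K * suc n * (K * x) + suc K * suc n * (K * y)
      ≡⟨ cong₂ (λ u v → suc K * suc n * u + suc K * suc n * v) Kx≡rd Ky≡[3+r]c ⟩
    suc K * suc n * (r * d) + suc K * suc n * ((3 + r) * c)
      ≡⟨ cong (_+ suc K * suc n * ((3 + r) * c)) (e₂ (suc K) (suc n) r d) ⟩
    suc K * r * (suc n * d) + suc K * suc n * ((3 + r) * c)
      ≡⟨ cong (λ u → suc K * r * u + suc K * suc n * ((3 + r) * c)) [1+n]d≡[2n+3+r]c ⟩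
    suc K * r * ((2 * n + 3 + r) * c) + suc K * suc n * ((3 + r) * c)
      ≡⟨ e₃ n r c ⟩
    K * suc r * (suc n * c) + K * suc r * ((2 * n + 3 + r) * c)
      ≡⟨ cong (λ u → K * suc r * (suc n * c) + K * suc r * u) [1+n]d≡[2n+3+r]c ⟨
    K * suc r * (suc n * c) + K * suc r * (suc n * d)
      ≡⟨ e₄ n r c d ⟩
    (K * suc n) * (suc r * (c + d))
      ∎)
  where
  open ≡-Reasoning
  K = 3 * suc n + r
  e₁ : ∀ n r x y → let K = 3 * suc n + r in
    (K * suc n) * (suc K * (x + y)) ≡ suc K * suc n * (K * x) + suc K * suc n * (K * y)
  e₁ = solve-∀
  e₂ : ∀ a b r d → a * b * (r * d) ≡ a * r * (b * d)
  e₂ = solve-∀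
  e₃ : ∀ n r c → let K = 3 * suc n + r in
    suc K * r * ((2 * n + 3 + r) * c) + suc K * suc n * ((3 + r) * c)
      ≡ K * suc r * (suc n * c) + K * suc r * ((2 * n + 3 + r) * c)
  e₃ = solve-∀
  e₄ : ∀ n r c d → let K = 3 * suc n + r in
    K * suc r * (suc n * c) + K * suc r * (suc n * d) ≡ (K * suc n) * (suc r * (c + d))
  e₄ = solve-∀

raney-closedForm : ∀ n r → (3 * n + r) * raney n r ≡ r * ((3 * n + r) C n)
raney-closedForm zero r = refl
raney-closedForm (suc n) zero = *-zeroʳ (3 * suc n + 0)
raney-closedForm (suc n) (suc r) = begin
  (3 * suc n + suc r) * (raney (suc n) r + raney n (3 + r))
    ≡⟨ cong (_* (raney (suc n) r + raney n (3 + r))) (+-suc (3 * suc n) r) ⟩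
  suc K * (raney (suc n) r + raney n (3 + r))
    ≡⟨ raney-closedForm-step n r (raney-closedForm (suc n) r)
         (subst (λ N → N * raney n (3 + r) ≡ (3 + r) * (N C n)) (e₁ n r) (raney-closedForm n (3 + r)))
         (subst (λ N → suc n * (N C suc n) ≡ (2 * n + 3 + r) * (N C n)) (e₂ n r)
           ([1+k]*[k+m]C[1+k]≡m*[k+m]Ck n (2 * n + 3 + r))) ⟩
  suc r * (K C n + K C suc n)
    ≡⟨ cong (suc r *_) ([1+n]C[1+k]≡nCk+nC[1+k] K n) ⟨
  suc r * (suc K C suc n)
    ≡⟨ cong (λ N → suc r * (N C suc n)) (+-suc (3 * suc n) r) ⟨
  suc r * ((3 * suc n + suc r) C suc n)
    ∎
  where
  open ≡-Reasoning
  K = 3 * suc n + r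
  e₁ : ∀ n r → 3 * n + (3 + r) ≡ 3 * suc n + r
  e₁ = solve-∀
  e₂ : ∀ n r → n + (2 * n + 3 + r) ≡ 3 * suc n + r
  e₂ = solve-∀

[2n+1]*raney[n,1]≡[3n]Cn : ∀ n → (2 * n + 1) * raney n 1 ≡ (3 * n) C n
[2n+1]*raney[n,1]≡[3n]Cn n = *-cancelˡ-≡ _ _ (suc (3 * n)) (begin
  suc (3 * n) * ((2 * n + 1) * raney n 1)  ≡⟨ cong (_* ((2 * n + 1) * raney n 1)) (+-comm 1 (3 * n)) ⟩
  (3 * n + 1) * ((2 * n + 1) * raney n 1)  ≡⟨ x∙yz≈y∙xz (3 * n + 1) (2 * n + 1) (raney n 1) ⟩
  (2 * n + 1) * ((3 * n + 1) * raney n 1)  ≡⟨ cong ((2 * n + 1) *_) (raney-closedForm n 1) ⟩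
  (2 * n + 1) * (1 * ((3 * n + 1) C n))    ≡⟨ cong ((2 * n + 1) *_) (*-identityˡ _) ⟩
  (2 * n + 1) * ((3 * n + 1) C n)          ≡⟨ absorb ⟩
  suc (3 * n) * ((3 * n) C n)              ∎)
  where
  open ≡-Reasoning
  n+2n≡3n : ∀ n → n + 2 * n ≡ 3 * n
  n+2n≡3n = solve-∀
  absorb : (2 * n + 1) * ((3 * n + 1) C n) ≡ suc (3 * n) * ((3 * n) C n)
  absorb = subst₂ (λ a N → a * (N C n) ≡ suc (3 * n) * ((3 * n) C n)) (+-comm 1 (2 * n)) (+-comm 1 (3 * n))
    (subst (λ N → suc (2 * n) * (suc N C n) ≡ suc N * (N C n)) (n+2n≡3n n)
      ([1+m]*[1+k+m]Ck≡[1+k+m]*[k+m]Ck n (2 * n)))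

[2n+1]*raney[n,2]≡[3n+1]C[n+1] : ∀ n → (2 * n + 1) * raney n 2 ≡ (3 * n + 1) C (n + 1)
[2n+1]*raney[n,2]≡[3n+1]C[n+1] n = *-cancelˡ-≡ _ _ (suc N * suc n) (begin
  (suc N * suc n) * ((2 * n + 1) * raney n 2)          ≡⟨ e₁ n (raney n 2) ⟩
  (2 * n + 1) * suc n * ((3 * n + 2) * raney n 2)      ≡⟨ cong ((2 * n + 1) * suc n *_) (raney-closedForm n 2) ⟩
  (2 * n + 1) * suc n * (2 * ((3 * n + 2) C n))        ≡⟨ e₂ n ((3 * n + 2) C n) ⟩
  (2 * n + 1) * (suc (2 * n + 1) * ((3 * n + 2) C n))  ≡⟨ cong (λ M → (2 * n + 1) * (suc (2 * n + 1) * (M C n)))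
                                                               (+-suc (3 * n) 1) ⟩
  (2 * n + 1) * (suc (2 * n + 1) * (suc N C n))        ≡⟨ cong ((2 * n + 1) *_) absorb ⟩
  (2 * n + 1) * (suc N * (N C n))                      ≡⟨ x∙yz≈y∙xz (2 * n + 1) (suc N) _ ⟩
  suc N * ((2 * n + 1) * (N C n))                      ≡⟨ cong (suc N *_) ratio ⟨
  suc N * (suc n * (N C suc n))                        ≡⟨ *-assoc (suc N) (suc n) _ ⟨
  (suc N * suc n) * (N C suc n)                        ≡⟨ cong (λ k → (suc N * suc n) * (N C k)) (+-comm 1 n) ⟩
  (suc N * suc n) * (N C (n + 1))                      ∎)
  where
  open ≡-Reasoning
  N = 3 * n + 1
  n+[2n+1]≡3n+1 : ∀ n → n + (2 * n + 1) ≡ 3 * n + 1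
  n+[2n+1]≡3n+1 = solve-∀
  absorb : suc (2 * n + 1) * (suc N C n) ≡ suc N * (N C n)
  absorb = subst (λ M → suc (2 * n + 1) * (suc M C n) ≡ suc M * (M C n)) (n+[2n+1]≡3n+1 n)
    ([1+m]*[1+k+m]Ck≡[1+k+m]*[k+m]Ck n (2 * n + 1))
  ratio : suc n * (N C suc n) ≡ (2 * n + 1) * (N C n)
  ratio = subst (λ M → suc n * (M C suc n) ≡ (2 * n + 1) * (M C n)) (n+[2n+1]≡3n+1 n)
    ([1+k]*[k+m]C[1+k]≡m*[k+m]Ck n (2 * n + 1))
  e₁ : ∀ n x → (suc (3 * n + 1) * suc n) * ((2 * n + 1) * x) ≡ (2 * n + 1) * suc n * ((3 * n + 2) * x)
  e₁ = solve-∀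
  e₂ : ∀ n x → (2 * n + 1) * suc n * (2 * x) ≡ (2 * n + 1) * (suc (2 * n + 1) * x)
  e₂ = solve-∀

-- The counting sequence

evenSplits : ℕ → List (ℕ × ℕ)
evenSplits zero = (0 , 0) ∷ []
evenSplits (suc zero) = (1 , 0) ∷ []
evenSplits (suc (suc n)) = (suc (suc n) , 0) ∷ map (map₂ (2 +_)) (evenSplits n)

evenᵇ-2+ : ∀ m → evenᵇ (2 + m) ≡ evenᵇ m
evenᵇ-2+ m = not-involutive (evenᵇ m)

∈-evenSplits⁻ : ∀ {k m} n → (k , m) ∈ evenSplits n → k + m ≡ n × T (evenᵇ m)
∈-evenSplits⁻ zero (here refl) = refl , _
∈-evenSplits⁻ (suc zero) (here refl) = refl , _
∈-evenSplits⁻ (suc (suc n)) (here refl) = +-identityʳ _ , _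
∈-evenSplits⁻ {k} (suc (suc n)) (there km∈)
  with (_ , m) , km′∈ , refl ← ∈-map⁻ (map₂ (2 +_)) km∈
  with k+m≡n , even-m ← ∈-evenSplits⁻ n km′∈ =
  trans (+-suc k (suc m)) (cong suc (trans (+-suc k m) (cong suc k+m≡n))) , subst T (sym (evenᵇ-2+ m)) even-m

∈-evenSplits⁺ : ∀ k m → T (evenᵇ m) → (k , m) ∈ evenSplits (k + m)
∈-evenSplits⁺ k zero _ = subst (λ n → (k , 0) ∈ evenSplits n) (sym (+-identityʳ k)) (head k)
  where
  head : ∀ n → (n , 0) ∈ evenSplits n
  head zero = here refl
  head (suc zero) = here refl
  head (suc (suc n)) = here refl
∈-evenSplits⁺ k 1 ()
∈-evenSplits⁺ k (suc (suc m)) even-m =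
  subst (λ n → (k , 2 + m) ∈ evenSplits n) (sym (trans (+-suc k (suc m)) (cong suc (+-suc k m))))
    (there (∈-map⁺ (map₂ (2 +_)) (∈-evenSplits⁺ k m (subst T (evenᵇ-2+ m) even-m))))

evenSplits-unique : ∀ n → Unique (evenSplits n)
evenSplits-unique zero = [] ∷ []
evenSplits-unique (suc zero) = [] ∷ []
evenSplits-unique (suc (suc n)) = tabulate head≢ ∷ Unique.map⁺ (λ where refl → refl) (evenSplits-unique n)
  where
  head≢ : ∀ {km} → km ∈ map (map₂ (2 +_)) (evenSplits n) → (suc (suc n) , 0) ≢ km
  head≢ km∈ refl with _ , _ , () ← ∈-map⁻ (map₂ (2 +_)) km∈

2[1+p]+b≡2+[2p+b] : ∀ p b → 2 * suc p + b ≡ 2 + (2 * p + b)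
2[1+p]+b≡2+[2p+b] = solve-∀

halve : ℕ → ℕ × ℕ
halve zero = 0 , 0
halve (suc zero) = 0 , 1
halve (suc (suc n)) = map₁ suc (halve n)

halve-2p+b : ∀ p {b} → b ≤ 1 → halve (2 * p + b) ≡ (p , b)
halve-2p+b zero z≤n = refl
halve-2p+b zero (s≤s z≤n) = refl
halve-2p+b (suc p) {b} b≤1 = trans (cong halve (2[1+p]+b≡2+[2p+b] p b)) (cong (map₁ suc) (halve-2p+b p b≤1))

2p+b-view : ∀ n → ∃₂ λ p b → b ≤ 1 × n ≡ 2 * p + b
2p+b-view zero = 0 , 0 , z≤n , refl
2p+b-view (suc zero) = 0 , 1 , s≤s z≤n , refl
2p+b-view (suc (suc n)) with p , b , b≤1 , refl ← 2p+b-view n = suc p , b , b≤1 , sym (2[1+p]+b≡2+[2p+b] p b)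

jacobiCount : ℕ → ℕ
jacobiCount n = let p , b = halve n in raney p (suc b)

jacobiCount-2p+b : ∀ p {b} → b ≤ 1 → jacobiCount (2 * p + b) ≡ raney p (suc b)
jacobiCount-2p+b p b≤1 rewrite halve-2p+b p b≤1 = refl

jacobiCount-even : ∀ p → jacobiCount (2 * p) ≡ raney p 1
jacobiCount-even p = trans (cong jacobiCount (sym (+-identityʳ (2 * p)))) (jacobiCount-2p+b p z≤n)

jacobiCount-odd : ∀ p → jacobiCount (2 * p + 1) ≡ raney p 2
jacobiCount-odd p = jacobiCount-2p+b p (s≤s z≤n)

splitSum : (ℕ → ℕ) → (ℕ → ℕ) → ℕ → ℕ
splitSum f g n = sum (map (λ (k , m) → f k * g m) (evenSplits n))

splitSum-convolution : ∀ f g {b} → b ≤ 1 →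
  ∀ p → splitSum f g (2 * p + b) ≡ convolution (λ i → f (2 * i + b)) (g ∘ (2 *_)) p
splitSum-convolution f g z≤n zero = +-identityʳ _
splitSum-convolution f g (s≤s z≤n) zero = +-identityʳ _
splitSum-convolution f g {b} b≤1 (suc p) = begin
  splitSum f g (2 * suc p + b)
    ≡⟨ cong (splitSum f g) (2[1+p]+b≡2+[2p+b] p b) ⟩
  f (2 + (2 * p + b)) * g 0 + sum (map (λ (k , m) → f k * g m) (map (map₂ (2 +_)) (evenSplits (2 * p + b))))
    ≡⟨ cong₂ _+_ (cong (λ n → f n * g 0) (sym (2[1+p]+b≡2+[2p+b] p b)))
                 (cong sum (sym (map-∘ (evenSplits (2 * p + b))))) ⟩
  f (2 * suc p + b) * g 0 + splitSum f (g ∘ (2 +_)) (2 * p + b)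
    ≡⟨ cong (f (2 * suc p + b) * g 0 +_) (splitSum-convolution f (g ∘ (2 +_)) b≤1 p) ⟩
  f (2 * suc p + b) * g 0 + convolution (λ i → f (2 * i + b)) (λ i → g (2 + 2 * i)) p
    ≡⟨ cong (f (2 * suc p + b) * g 0 +_) (convolution-cong (λ _ → refl) (λ i → cong g (sym (*-suc 2 i))) p) ⟩
  convolution (λ i → f (2 * i + b)) (g ∘ (2 *_)) (suc p)
    ∎
  where open ≡-Reasoning

jacobiCount-suc : ∀ n → jacobiCount (suc n) ≡ splitSum jacobiCount jacobiCount n
jacobiCount-suc n with p , b , b≤1 , refl ← 2p+b-view n = begin
  jacobiCount (suc (2 * p + b))
    ≡⟨ jacobiCount-1+2p+b b≤1 ⟩
  raney p (1 + suc b)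
    ≡⟨ raney-+ (suc b) 1 p ⟩
  convolution (λ i → raney i (suc b)) (λ i → raney i 1) p
    ≡⟨ convolution-cong (λ i → jacobiCount-2p+b i b≤1) jacobiCount-even p ⟨
  convolution (λ i → jacobiCount (2 * i + b)) (jacobiCount ∘ (2 *_)) p
    ≡⟨ splitSum-convolution jacobiCount jacobiCount b≤1 p ⟨
  splitSum jacobiCount jacobiCount (2 * p + b)
    ∎
  where
  open ≡-Reasoning
  jacobiCount-1+2p+b : ∀ {b} → b ≤ 1 → jacobiCount (suc (2 * p + b)) ≡ raney p (1 + suc b)
  jacobiCount-1+2p+b z≤n = trans (cong jacobiCount (sym (+-suc (2 * p) 0))) (jacobiCount-odd p)
  jacobiCount-1+2p+b (s≤s z≤n) =
    trans (cong jacobiCount (trans (cong suc (+-suc (2 * p) 0)) (sym (2[1+p]+b≡2+[2p+b] p 0))))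
          (jacobiCount-2p+b (suc p) z≤n)

private variable
  A B D : Set
  xs ys : List A

∈-++-∷⁻ : ∀ α {β} {x y : A} → y ∈ α ++ x ∷ β → y ≢ x → y ∈ α ++ β
∈-++-∷⁻ α y∈ y≢x with ∈-++⁻ α y∈
... | inj₁ y∈α = ∈-++⁺ˡ y∈α
... | inj₂ (here refl) = contradiction refl y≢x
... | inj₂ (there y∈β) = ∈-++⁺ʳ α y∈β

∈-++-∷⁺ : ∀ α {β} {x y : A} → y ∈ α ++ β → y ∈ α ++ x ∷ β
∈-++-∷⁺ α y∈ = [ ∈-++⁺ˡ , ∈-++⁺ʳ α ∘ there ]′ (∈-++⁻ α y∈)

∈-++-comm : ∀ xs {ys} {y : A} → y ∈ xs ++ ys → y ∈ ys ++ xs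
∈-++-comm xs {ys} y∈ = [ ∈-++⁺ʳ ys , ∈-++⁺ˡ ]′ (∈-++⁻ xs y∈)

length-++-∷ : ∀ α {x : A} {β} → length (α ++ x ∷ β) ≡ suc (length (α ++ β))
length-++-∷ α {x} {β} = trans (length-++ α) (trans (+-suc (length α) (length β)) (cong suc (sym (length-++ α))))

Unique-++⁻ : ∀ xs → Unique (xs ++ ys) → Unique xs × Unique ys × Disjoint xs ys
Unique-++⁻ [] ys! = [] , ys! , λ ()
Unique-++⁻ (x ∷ xs) (x∉ ∷ xsys!) with xs! , ys! , xs#ys ← Unique-++⁻ xs xsys! =
  (anti-mono ∈-++⁺ˡ x∉ ∷ xs!) , ys! , λ where
    (here refl , v∈ys) → lookup x∉ (∈-++⁺ʳ xs v∈ys) refl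
    (there v∈xs , v∈ys) → xs#ys (v∈xs , v∈ys)

Unique-++-comm : ∀ xs → Unique (xs ++ ys) → Unique (ys ++ xs)
Unique-++-comm xs xsys! with xs! , ys! , xs#ys ← Unique-++⁻ xs xsys! =
  Unique.++⁺ ys! xs! λ (v∈ys , v∈xs) → xs#ys (v∈xs , v∈ys)

unique-⊆⇒length≤ : Unique xs → xs ⊆ ys → length xs ≤ length ys
unique-⊆⇒length≤ {xs = []} _ _ = z≤n
unique-⊆⇒length≤ {xs = x ∷ xs} (x∉xs ∷ xs!) xs⊆ys
  with ys₁ , ys₂ , refl ← ∈-∃++ (xs⊆ys (here refl)) =
  subst (suc (length xs) ≤_) (sym (length-++-∷ ys₁))
    (s≤s (unique-⊆⇒length≤ xs! λ z∈xs → ∈-++-∷⁻ ys₁ (xs⊆ys (there z∈xs)) (lookup x∉xs z∈xs ∘ sym)))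

unique-⊆⊇⇒length≡ : Unique xs → Unique ys → xs ⊆ ys → ys ⊆ xs → length xs ≡ length ys
unique-⊆⊇⇒length≡ xs! ys! xs⊆ys ys⊆xs = ≤-antisym (unique-⊆⇒length≤ xs! xs⊆ys) (unique-⊆⇒length≤ ys! ys⊆xs)

Unique-concatMap⁺ : ∀ (f : A → List B) {xs} → Unique xs → (∀ {x} → x ∈ xs → Unique (f x)) →
  (∀ {x y v} → x ∈ xs → y ∈ xs → v ∈ f x → v ∈ f y → x ≡ y) → Unique (concatMap f xs)
Unique-concatMap⁺ f {[]} _ _ _ = []
Unique-concatMap⁺ f {x ∷ xs} (x∉xs ∷ xs!) f! f# = Unique.++⁺ (f! (here refl))
  (Unique-concatMap⁺ f xs! (f! ∘ there) (λ x∈ y∈ → f# (there x∈) (there y∈))) disjoint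
  where
  disjoint : Disjoint (f x) (concatMap f xs)
  disjoint (v∈fx , v∈rest) with y , y∈xs , v∈fy ← find (∈-concatMap⁻ f v∈rest) =
    lookup x∉xs y∈xs (f# (here refl) (there y∈xs) v∈fx v∈fy)

Unique-cartesianProductWith⁺ : ∀ (f : A → B → D) {xs ys} → Unique xs → Unique ys →
  (∀ {w x y z} → w ∈ xs → x ∈ xs → f w y ≡ f x z → w ≡ x × y ≡ z) →
  Unique (cartesianProductWith f xs ys)
Unique-cartesianProductWith⁺ f {[]} _ _ _ = []
Unique-cartesianProductWith⁺ f {x ∷ xs} {ys} (x∉xs ∷ xs!) ys! f-inj =
  Unique.++⁺ (Unique.map⁺ (λ eq → proj₂ (f-inj (here refl) (here refl) eq)) ys!)
    (Unique-cartesianProductWith⁺ f xs! ys! (λ w∈ x∈ → f-inj (there w∈) (there x∈))) disjoint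
  where
  disjoint : Disjoint (map (f x) ys) (cartesianProductWith f xs ys)
  disjoint (v∈map , v∈rest)
    with b , _ , refl ← ∈-map⁻ (f x) v∈map
    with a , _ , a∈xs , _ , eq ← ∈-cartesianProductWith⁻ f xs ys v∈rest =
    lookup x∉xs a∈xs (proj₁ (f-inj (here refl) (there a∈xs) eq))

length-concatMap : ∀ (f : A → List B) xs → length (concatMap f xs) ≡ sum (map (length ∘ f) xs)
length-concatMap f [] = refl
length-concatMap f (x ∷ xs) = trans (length-++ (f x)) (cong (length (f x) +_) (length-concatMap f xs))

length-cartesianProductWith : ∀ (f : A → B → D) xs ys →
  length (cartesianProductWith f xs ys) ≡ length xs * length ys
length-cartesianProductWith f [] ys = refl
length-cartesianProductWith f (x ∷ xs) ys = begin
  length (map (f x) ys ++ cartesianProductWith f xs ys)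
    ≡⟨ length-++ (map (f x) ys) ⟩
  length (map (f x) ys) + length (cartesianProductWith f xs ys)
    ≡⟨ cong₂ _+_ (length-map (f x) ys) (length-cartesianProductWith f xs ys) ⟩
  length ys + length xs * length ys
    ∎
  where open ≡-Reasoning

++-∷-cancel : ∀ {x : A} α {α′ β β′} → x ∉ α → x ∉ α′ → α ++ x ∷ β ≡ α′ ++ x ∷ β′ → α ≡ α′ × β ≡ β′
++-∷-cancel [] {[]} _ _ eq = refl , proj₂ (∷-injective eq)
++-∷-cancel [] {y ∷ α′} _ x∉α′ eq = contradiction (here (proj₁ (∷-injective eq))) x∉α′
++-∷-cancel (y ∷ α) {[]} x∉α _ eq = contradiction (here (sym (proj₁ (∷-injective eq)))) x∉α
++-∷-cancel (y ∷ α) {y′ ∷ α′} x∉α x∉α′ eq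
  with refl , eq′ ← ∷-injective eq
  with refl , refl ← ++-∷-cancel α (x∉α ∘ there) (x∉α′ ∘ there) eq′ = refl , refl

-- Arrangements of intervals

InRange : ℕ → ℕ → ℕ → Set
InRange lo n y = lo ≤ y × y < lo + n

range : ℕ → ℕ → List ℕ
range lo n = applyUpTo (lo +_) n

∈-range⁻ : ∀ {lo n y} → y ∈ range lo n → InRange lo n y
∈-range⁻ {lo} y∈ with i , i<n , refl ← ∈-applyUpTo⁻ (lo +_) y∈ = m≤m+n lo i , +-monoʳ-< lo i<n

∈-range⁺ : ∀ {lo n y} → InRange lo n y → y ∈ range lo n
∈-range⁺ {lo} {n} (lo≤y , y<lo+n) = subst (_∈ range lo n) lo+[y∸lo]≡y
  (∈-applyUpTo⁺ (lo +_) (+-cancelˡ-< lo _ n (subst (_< lo + n) (sym lo+[y∸lo]≡y) y<lo+n)))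
  where lo+[y∸lo]≡y = m+[n∸m]≡n lo≤y

range-unique : ∀ lo n → Unique (range lo n)
range-unique lo n = Unique.applyUpTo⁺₁ (lo +_) n (λ i<j _ → <⇒≢ (+-monoʳ-< lo i<j))

record Arrangement (lo n : ℕ) (w : List ℕ) : Set where
  field
    unique : Unique w
    bounded : ∀ {y} → y ∈ w → InRange lo n y
    complete : ∀ {y} → InRange lo n y → y ∈ w

  length≡ : length w ≡ n
  length≡ = trans (unique-⊆⊇⇒length≡ unique (range-unique lo n) (∈-range⁺ ∘ bounded) (complete ∘ ∈-range⁻))
                  (length-applyUpTo (lo +_) n)

  lowerBound : ∀ {y} → y ∈ w → lo ≤ y
  lowerBound = proj₁ ∘ bounded

open Arrangement

Arrangement-[] : ∀ lo → Arrangement lo 0 []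
Arrangement-[] lo = record
  { unique = []
  ; bounded = λ ()
  ; complete = λ {y} (lo≤y , y<lo+0) → contradiction (subst (y <_) (+-identityʳ lo) y<lo+0) (≤⇒≯ lo≤y)
  }

Arrangement-0⇒≡[] : ∀ {lo w} → Arrangement lo 0 w → w ≡ []
Arrangement-0⇒≡[] {w = []} _ = refl
Arrangement-0⇒≡[] {w = _ ∷ _} arr with () ← length≡ arr

Arrangement-min∈ : ∀ {lo n w} → Arrangement lo (suc n) w → lo ∈ w
Arrangement-min∈ {lo} arr = complete arr (≤-refl , m<m+n lo z<s)

Arrangement-above : ∀ {lo l k α} → lo < l → Arrangement l k α → All (lo <_) α
Arrangement-above lo<l arr = tabulate (λ y∈ → <-≤-trans lo<l (lowerBound arr y∈))

Arrangement-insertMin : ∀ {lo n} α {β} → Arrangement (suc lo) n (α ++ β) → Arrangement lo (suc n) (α ++ lo ∷ β)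
Arrangement-insertMin {lo} {n} α {β} arr = record
  { unique = Unique.++⁺ α! (tabulate (λ y∈β → lo≢ (∈-++⁺ʳ α y∈β)) ∷ β!) disjoint
  ; bounded = bounded′
  ; complete = complete′
  }
  where
  α!β! = Unique-++⁻ α (unique arr)
  α! = proj₁ α!β!
  β! = proj₁ (proj₂ α!β!)
  lo≢ : ∀ {y} → y ∈ α ++ β → lo ≢ y
  lo≢ y∈ refl = <-irrefl refl (lowerBound arr y∈)
  disjoint : Disjoint α (lo ∷ β)
  disjoint (y∈α , here refl) = lo≢ (∈-++⁺ˡ y∈α) refl
  disjoint (y∈α , there y∈β) = proj₂ (proj₂ α!β!) (y∈α , y∈β)
  widen : ∀ {y} → y ∈ α ++ β → InRange lo (suc n) y
  widen {y} y∈ with lo<y , y<1+lo+n ← bounded arr y∈ = <⇒≤ lo<y , subst (y <_) (sym (+-suc lo n)) y<1+lo+n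
  bounded′ : ∀ {y} → y ∈ α ++ lo ∷ β → InRange lo (suc n) y
  bounded′ y∈ with ∈-++⁻ α y∈
  ... | inj₁ y∈α = widen (∈-++⁺ˡ y∈α)
  ... | inj₂ (here refl) = ≤-refl , m<m+n lo z<s
  ... | inj₂ (there y∈β) = widen (∈-++⁺ʳ α y∈β)
  complete′ : ∀ {y} → InRange lo (suc n) y → y ∈ α ++ lo ∷ β
  complete′ {y} (lo≤y , y<lo+1+n) with lo ≟ y
  ... | yes refl = ∈-insert α
  ... | no lo≢y = ∈-++-∷⁺ α (complete arr (≤∧≢⇒< lo≤y lo≢y , subst (y <_) (+-suc lo n) y<lo+1+n))

Arrangement-removeMin : ∀ {lo n} α {β} → Arrangement lo (suc n) (α ++ lo ∷ β) → Arrangement (suc lo) n (α ++ β)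
Arrangement-removeMin {lo} {n} α {β} arr = record
  { unique = Unique.++⁺ α! β! (λ (y∈α , y∈β) → α#loβ (y∈α , there y∈β))
  ; bounded = λ {y} y∈ → let lo≤y , y<lo+1+n = bounded arr (∈-++-∷⁺ α y∈) in
      ≤∧≢⇒< lo≤y (lo≢ y∈) , subst (y <_) (+-suc lo n) y<lo+1+n
  ; complete = λ {y} (lo<y , y<1+lo+n) →
      ∈-++-∷⁻ α (complete arr (<⇒≤ lo<y , subst (y <_) (sym (+-suc lo n)) y<1+lo+n)) (>⇒≢ lo<y)
  }
  where
  α!loβ! = Unique-++⁻ α (unique arr)
  α! = proj₁ α!loβ!
  α#loβ = proj₂ (proj₂ α!loβ!)
  β! : Unique β
  β! with _ ∷ β! ← proj₁ (proj₂ α!loβ!) = β!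
  lo≢ : ∀ {y} → y ∈ α ++ β → lo ≢ y
  lo≢ y∈ refl with ∈-++⁻ α y∈ | proj₁ (proj₂ α!loβ!)
  ... | inj₁ lo∈α | _ = α#loβ (lo∈α , here refl)
  ... | inj₂ lo∈β | lo∉β ∷ _ = lookup lo∉β lo∈β refl

Arrangement-++-comm : ∀ {lo n} u {v} → Arrangement lo n (u ++ v) → Arrangement lo n (v ++ u)
Arrangement-++-comm u {v} arr = record
  { unique = Unique-++-comm u (unique arr)
  ; bounded = bounded arr ∘ ∈-++-comm v
  ; complete = ∈-++-comm u ∘ complete arr
  }

Arrangement-++-distinct : ∀ {lo n} α {β y z} → Arrangement lo n (α ++ β) → y ∈ α → z ∈ β → y ≢ z
Arrangement-++-distinct α arr y∈α z∈β refl = proj₂ (proj₂ (Unique-++⁻ α (unique arr))) (y∈α , z∈β)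

_≺_ : List ℕ → List ℕ → Set
u ≺ v = ∀ {y z} → y ∈ u → z ∈ v → y < z

Arrangement-++⁺ : ∀ {lo k m u v} → Arrangement lo k u → Arrangement (lo + k) m v →
  Arrangement lo (k + m) (u ++ v) × u ≺ v
Arrangement-++⁺ {lo} {k} {m} {u} {v} arrᵤ arrᵥ = record
  { unique = Unique.++⁺ (unique arrᵤ) (unique arrᵥ) (λ (y∈u , y∈v) → <-irrefl refl (u≺v y∈u y∈v))
  ; bounded = bounded′
  ; complete = complete′
  } , u≺v
  where
  u≺v : u ≺ v
  u≺v y∈u z∈v = <-≤-trans (proj₂ (bounded arrᵤ y∈u)) (lowerBound arrᵥ z∈v)
  bounded′ : ∀ {y} → y ∈ u ++ v → InRange lo (k + m) y
  bounded′ {y} y∈ with ∈-++⁻ u y∈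
  ... | inj₁ y∈u = let lo≤y , y<lo+k = bounded arrᵤ y∈u in
      lo≤y , <-≤-trans y<lo+k (+-monoʳ-≤ lo (m≤m+n k m))
  ... | inj₂ y∈v = let lo+k≤y , y<lo+k+m = bounded arrᵥ y∈v in
      ≤-trans (m≤m+n lo k) lo+k≤y , subst (y <_) (+-assoc lo k m) y<lo+k+m
  complete′ : ∀ {y} → InRange lo (k + m) y → y ∈ u ++ v
  complete′ {y} (lo≤y , y<lo+[k+m]) with y <? lo + k
  ... | yes y<lo+k = ∈-++⁺ˡ (complete arrᵤ (lo≤y , y<lo+k))
  ... | no y≮lo+k = ∈-++⁺ʳ u (complete arrᵥ (≮⇒≥ y≮lo+k , subst (y <_) (sym (+-assoc lo k m)) y<lo+[k+m]))

-- If y ≥ lo + |u|, then u would contain all of lo, …, y: more than |u| letters.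
Arrangement-++-≺⇒u<lo+|u| : ∀ {lo n} u {v y} → Arrangement lo n (u ++ v) → u ≺ v → y ∈ u → y < lo + length u
Arrangement-++-≺⇒u<lo+|u| {lo} u {v} {y} arr u≺v y∈u = ≰⇒> λ lo+|u|≤y →
  <⇒≱ pigeonhole (+-cancelˡ-≤ lo _ (y ∸ lo) (subst (lo + length u ≤_) (sym lo+d≡y) lo+|u|≤y))
  where
  lo+d≡y = m+[n∸m]≡n (lowerBound arr (∈-++⁺ˡ y∈u))
  [lo,y]⊆u : ∀ {t} → t ∈ range lo (suc (y ∸ lo)) → t ∈ u
  [lo,y]⊆u {t} t∈ = [ (λ t∈u → t∈u) , (λ t∈v → contradiction (u≺v y∈u t∈v) (≤⇒≯ t≤y)) ]′
    (∈-++⁻ u (complete arr (proj₁ (∈-range⁻ t∈) , ≤-<-trans t≤y (proj₂ (bounded arr (∈-++⁺ˡ y∈u))))))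
    where
    t≤y : t ≤ y
    t≤y = <⇒≤pred (subst (t <_) (trans (+-suc lo _) (cong suc lo+d≡y)) (proj₂ (∈-range⁻ t∈)))
  pigeonhole : suc (y ∸ lo) ≤ length u
  pigeonhole = subst (_≤ length u) (length-applyUpTo (lo +_) (suc (y ∸ lo)))
    (unique-⊆⇒length≤ (range-unique lo _) [lo,y]⊆u)

-- If z < lo + |u|, then u would fit into the fewer than |u| values lo, …, z - 1.
Arrangement-++-≺⇒lo+|u|≤v : ∀ {lo n} u {v z} → Arrangement lo n (u ++ v) → u ≺ v → z ∈ v → lo + length u ≤ z
Arrangement-++-≺⇒lo+|u|≤v {lo} u {v} {z} arr u≺v z∈v = ≮⇒≥ λ z<lo+|u| →
  <⇒≱ (+-cancelˡ-< lo (z ∸ lo) _ (subst (_< lo + length u) (sym lo+d≡z) z<lo+|u|)) pigeonhole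
  where
  lo+d≡z = m+[n∸m]≡n (lowerBound arr (∈-++⁺ʳ u z∈v))
  u⊆[lo,z-1] : ∀ {y} → y ∈ u → y ∈ range lo (z ∸ lo)
  u⊆[lo,z-1] {y} y∈u = ∈-range⁺ (lowerBound arr (∈-++⁺ˡ y∈u) , subst (y <_) (sym lo+d≡z) (u≺v y∈u z∈v))
  pigeonhole : length u ≤ z ∸ lo
  pigeonhole = subst (length u ≤_) (length-applyUpTo (lo +_) (z ∸ lo))
    (unique-⊆⇒length≤ (proj₁ (Unique-++⁻ u (unique arr))) u⊆[lo,z-1])

Arrangement-++⁻ : ∀ {lo n} u {v} → Arrangement lo n (u ++ v) → u ≺ v →
  Arrangement lo (length u) u × Arrangement (lo + length u) (length v) v
Arrangement-++⁻ {lo} {n} u {v} arr u≺v = arrᵤ , arrᵥ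
  where
  k = length u
  m = length v
  lo+n≡lo+k+m : lo + n ≡ lo + k + m
  lo+n≡lo+k+m = trans (cong (lo +_) (trans (sym (length≡ arr)) (length-++ u))) (sym (+-assoc lo k m))
  u!v! = Unique-++⁻ u (unique arr)
  u<lo+k : ∀ {y} → y ∈ u → y < lo + k
  u<lo+k = Arrangement-++-≺⇒u<lo+|u| u arr u≺v
  lo+k≤v : ∀ {z} → z ∈ v → lo + k ≤ z
  lo+k≤v = Arrangement-++-≺⇒lo+|u|≤v u arr u≺v
  arrᵤ : Arrangement lo k u
  arrᵤ = record
    { unique = proj₁ u!v!
    ; bounded = λ y∈u → lowerBound arr (∈-++⁺ˡ y∈u) , u<lo+k y∈u
    ; complete = λ {y} (lo≤y , y<lo+k) →
        [ (λ y∈u → y∈u) , (λ y∈v → contradiction (lo+k≤v y∈v) (<⇒≱ y<lo+k)) ]′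
        (∈-++⁻ u (complete arr (lo≤y , <-≤-trans y<lo+k (subst (lo + k ≤_) (sym lo+n≡lo+k+m) (m≤m+n _ m)))))
    }
  arrᵥ : Arrangement (lo + k) m v
  arrᵥ = record
    { unique = proj₁ (proj₂ u!v!)
    ; bounded = λ {z} z∈v → lo+k≤v z∈v , subst (z <_) lo+n≡lo+k+m (proj₂ (bounded arr (∈-++⁺ʳ u z∈v)))
    ; complete = λ {z} (lo+k≤z , z<lo+k+m) →
        [ (λ z∈u → contradiction (u<lo+k z∈u) (≤⇒≯ lo+k≤z)) , (λ z∈v → z∈v) ]′
        (∈-++⁻ u (complete arr (≤-trans (m≤m+n lo k) lo+k≤z , subst (z <_) (sym lo+n≡lo+k+m) z<lo+k+m)))
    }

∈-words⁺ : ∀ as k {w} → length w ≡ k → All (_∈ as) w → w ∈ words as k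
∈-words⁺ as zero {[]} refl [] = here refl
∈-words⁺ as (suc k) {x ∷ w} refl (x∈as ∷ w⊆as) =
  ∈-concatMap⁺ (λ a → map (a ∷_) (words as k)) (lose x∈as (∈-map⁺ (x ∷_) (∈-words⁺ as k refl w⊆as)))

words-unique : ∀ {as} k → Unique as → Unique (words as k)
words-unique zero _ = [] ∷ []
words-unique {as} (suc k) as! = Unique-concatMap⁺ (λ a → map (a ∷_) (words as k)) as!
  (λ _ → Unique.map⁺ ∷-injectiveʳ (words-unique k as!)) sameHead
  where
  sameHead : ∀ {a b v} → a ∈ as → b ∈ as → v ∈ map (a ∷_) (words as k) → v ∈ map (b ∷_) (words as k) → a ≡ b
  sameHead _ _ v∈a v∈b with _ , _ , refl ← ∈-map⁻ _ v∈a with _ , _ , eq ← ∈-map⁻ _ v∈b = ∷-injectiveˡ eq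

occ-∷-≡ : ∀ y w → occ y (y ∷ w) ≡ suc (occ y w)
occ-∷-≡ y w rewrite to T-≡ (≡⇒≡ᵇ y y refl) = refl

occ-∷-≢ : ∀ {y x} w → y ≢ x → occ y (x ∷ w) ≡ occ y w
occ-∷-≢ {y} {x} w y≢x with y ≡ᵇ x in eq
... | true = contradiction (≡ᵇ⇒≡ y x (from T-≡ eq)) y≢x
... | false = refl

occ-∉ : ∀ {y} w → y ∉ w → occ y w ≡ 0
occ-∉ [] _ = refl
occ-∉ (x ∷ w) y∉ = trans (occ-∷-≢ w (y∉ ∘ here)) (occ-∉ w (y∉ ∘ there))

occ-∈⁺ : ∀ {y w} → y ∈ w → 0 < occ y w
occ-∈⁺ {y} (here {xs = w} refl) = subst (0 <_) (sym (occ-∷-≡ y w)) z<s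
occ-∈⁺ {y} (there {x = x} {xs = w} y∈w) = <-≤-trans (occ-∈⁺ y∈w) occ≤occ-∷
  where
  occ≤occ-∷ : occ y w ≤ occ y (x ∷ w)
  occ≤occ-∷ with y ≡ᵇ x
  ... | true = n≤1+n _
  ... | false = ≤-refl

occ-∈⁻ : ∀ {y} w → 0 < occ y w → y ∈ w
occ-∈⁻ {y} (x ∷ w) 0<occ with y ≡ᵇ x in eq
... | true = here (≡ᵇ⇒≡ y x (from T-≡ eq))
... | false = there (occ-∈⁻ w 0<occ)

occ-unique : ∀ {y w} → Unique w → y ∈ w → occ y w ≡ 1
occ-unique {y} (x∉w ∷ _) (here {xs = w} refl) =
  trans (occ-∷-≡ y w) (cong suc (occ-∉ w (λ y∈w → lookup x∉w y∈w refl)))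
occ-unique (x∉w ∷ w!) (there {xs = w} y∈w) =
  trans (occ-∷-≢ w (lookup x∉w y∈w ∘ sym)) (occ-unique w! y∈w)

occ≡1⇒unique : ∀ w → (∀ {y} → y ∈ w → occ y w ≡ 1) → Unique w
occ≡1⇒unique [] _ = []
occ≡1⇒unique (x ∷ w) occ≡1 = tabulate (λ y∈w x≡y → x∉w (subst (_∈ w) (sym x≡y) y∈w)) ∷ occ≡1⇒unique w tail
  where
  x∉w : x ∉ w
  x∉w x∈w = m<n⇒n≢0 (occ-∈⁺ x∈w) (suc-injective (trans (sym (occ-∷-≡ x w)) (occ≡1 (here refl))))
  tail : ∀ {y} → y ∈ w → occ y w ≡ 1
  tail {y} y∈w = trans (sym (occ-∷-≢ w λ where refl → x∉w y∈w)) (occ≡1 (there y∈w))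

private
  isPermOf? : ∀ n (w : List ℕ) → Dec (isPermOf n w ≡ true)
  isPermOf? n w = isPermOf n w Bool.≟ true

-- oneTo n and range 1 n are definitionally the same list.
perms-unique : ∀ n → Unique (perms n)
perms-unique n = Unique.filter⁺ (isPermOf? n) (words-unique n (range-unique 1 n))

∈-perms⁻ : ∀ {n w} → w ∈ perms n → Arrangement 1 n w
∈-perms⁻ {n} {w} w∈ = record
  { unique = occ≡1⇒unique w (occ≡1 ∘ ∈oneTo)
  ; bounded = ∈-range⁻ ∘ ∈oneTo
  ; complete = λ y∈[1,n] → occ-∈⁻ w (subst (0 <_) (sym (occ≡1 (∈-range⁺ y∈[1,n]))) z<s)
  }
  where
  isPerm = from T-≡ (proj₂ (∈-filter⁻ (isPermOf? n) {xs = words (oneTo n) n} w∈))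
  occs = to T-∧ (proj₂ (to (T-∧ {length w ≡ᵇ n}) isPerm))
  occ≡1 : ∀ {i} → i ∈ oneTo n → occ i w ≡ 1
  occ≡1 i∈ = ≡ᵇ⇒≡ _ 1 (lookup (all⁺ _ (oneTo n) (proj₁ occs)) i∈)
  ∈oneTo : ∀ {y} → y ∈ w → y ∈ oneTo n
  ∈oneTo y∈ with i , i∈ , y≡ᵇi ← find (any⁻ _ (oneTo n) (lookup (all⁺ _ w (proj₂ occs)) y∈)) =
    subst (_∈ oneTo n) (sym (≡ᵇ⇒≡ _ i y≡ᵇi)) i∈

∈-perms⁺ : ∀ {n w} → Arrangement 1 n w → w ∈ perms n
∈-perms⁺ {n} {w} arr = ∈-filter⁺ (isPermOf? n)
  (∈-words⁺ (oneTo n) n (length≡ arr) (tabulate (∈-range⁺ ∘ bounded arr)))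
  (to T-≡ (from T-∧ (≡⇒≡ᵇ _ n (length≡ arr) , from T-∧ (all⁻ _ (tabulate occ≡1) , all⁻ _ (tabulate ∈oneTo)))))
  where
  occ≡1 : ∀ {i} → i ∈ oneTo n → T (occ i w ≡ᵇ 1)
  occ≡1 i∈ = ≡⇒≡ᵇ _ 1 (occ-unique (unique arr) (complete arr (∈-range⁻ i∈)))
  ∈oneTo : ∀ {y} → y ∈ w → T (any (y ≡ᵇ_) (oneTo n))
  ∈oneTo {y} y∈ = any⁺ _ (lose (∈-range⁺ (bounded arr y∈)) (≡⇒≡ᵇ y y refl))

-- Pattern occurrences

∈-subwords⁺ : ∀ {s w} → s ⊑ w → s ∈ subwords w
∈-subwords⁺ [] = here refl
∈-subwords⁺ (_∷ʳ_ {ys = w} x s⊑w) = ∈-++⁺ʳ (map (x ∷_) (subwords w)) (∈-subwords⁺ s⊑w)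
∈-subwords⁺ (refl ∷ s⊑w) = ∈-++⁺ˡ (∈-map⁺ _ (∈-subwords⁺ s⊑w))

∈-subwords⁻ : ∀ {s} w → s ∈ subwords w → s ⊑ w
∈-subwords⁻ [] (here refl) = []
∈-subwords⁻ (x ∷ w) s∈ with ∈-++⁻ (map (x ∷_) (subwords w)) s∈
... | inj₁ s∈xw with s′ , s′∈ , refl ← ∈-map⁻ (x ∷_) s∈xw = refl ∷ ∈-subwords⁻ w s′∈
... | inj₂ s∈w = x ∷ʳ ∈-subwords⁻ w s∈w

∈-⊑ : ∀ {y : ℕ} {s w} → y ∈ s → s ⊑ w → y ∈ w
∈-⊑ y∈s s⊑w = Sublist.lookup s⊑w y∈s

⊑-++⁻ : ∀ (α : List ℕ) {β s} → s ⊑ α ++ β → ∃₂ λ s₁ s₂ → s ≡ s₁ ++ s₂ × s₁ ⊑ α × s₂ ⊑ β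
⊑-++⁻ [] s⊑β = [] , _ , refl , [] , s⊑β
⊑-++⁻ (x ∷ α) (.x ∷ʳ s⊑) with s₁ , s₂ , refl , s₁⊑α , s₂⊑β ← ⊑-++⁻ α s⊑ =
  s₁ , s₂ , refl , x ∷ʳ s₁⊑α , s₂⊑β
⊑-++⁻ (x ∷ α) (refl ∷ s⊑) with s₁ , s₂ , refl , s₁⊑α , s₂⊑β ← ⊑-++⁻ α s⊑ =
  x ∷ s₁ , s₂ , refl , refl ∷ s₁⊑α , s₂⊑β

Occurs : (ℕ → ℕ → ℕ → Set) → List ℕ → Set
Occurs R w = ∃₂ λ p q → ∃ λ r → R p q r × (p ∷ q ∷ r ∷ []) ⊑ w

Occurs-⊑ : ∀ {R u w} → u ⊑ w → Occurs R u → Occurs R w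
Occurs-⊑ u⊑w (p , q , r , pqr , occ) = p , q , r , pqr , ⊆-trans occ u⊑w

Occurs-++-∷⁺ : ∀ {R : ℕ → ℕ → ℕ → Set} {x y z} α {β} → y ∈ α → z ∈ β → R y x z → Occurs R (α ++ x ∷ β)
Occurs-++-∷⁺ α y∈α z∈β yxz = _ , _ , _ , yxz , ++⁺ (from∈ y∈α) (refl ∷ from∈ z∈β)

Occurs-++-∷⁻ : ∀ {R x} α β →
  (∀ {q r} → q ∈ β → r ∈ β → ¬ R x q r) →
  (∀ {p q r} → p ∈ α → r ∈ β → ¬ R p q r) →
  (∀ {p q} → p ∈ α → q ∈ α → ¬ R p q x) →
  Occurs R (α ++ x ∷ β) → Occurs R α ⊎ Occurs R β
Occurs-++-∷⁻ {R} {x} α β ¬R[x,β,β] ¬R[α,_,β] ¬R[α,α,x] (p , q , r , pqr , occ)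
  with s₁ , s₂ , eq , s₁⊑α , s₂⊑xβ ← ⊑-++⁻ α occ = cases s₁ s₂ eq s₁⊑α s₂⊑xβ
  where
  first : ∀ {a s t} → a ∷ s ⊑ t → a ∈ t
  first = ∈-⊑ (here refl)
  second : ∀ {a b s t} → a ∷ b ∷ s ⊑ t → b ∈ t
  second = ∈-⊑ (there (here refl))
  cases : ∀ s₁ s₂ → p ∷ q ∷ r ∷ [] ≡ s₁ ++ s₂ → s₁ ⊑ α → s₂ ⊑ x ∷ β → Occurs R α ⊎ Occurs R β
  cases [] _ refl _ (.x ∷ʳ pqr⊑β) = inj₂ (p , q , r , pqr , pqr⊑β)
  cases [] _ refl _ (refl ∷ qr⊑β) = contradiction pqr (¬R[x,β,β] (first qr⊑β) (second qr⊑β))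
  cases (_ ∷ []) _ refl p⊑α (_ ∷ʳ qr⊑β) = contradiction pqr (¬R[α,_,β] (first p⊑α) (second qr⊑β))
  cases (_ ∷ []) _ refl p⊑α (refl ∷ r⊑β) = contradiction pqr (¬R[α,_,β] (first p⊑α) (first r⊑β))
  cases (_ ∷ _ ∷ []) _ refl pq⊑α (_ ∷ʳ r⊑β) = contradiction pqr (¬R[α,_,β] (first pq⊑α) (first r⊑β))
  cases (_ ∷ _ ∷ []) _ refl pq⊑α (refl ∷ _) = contradiction pqr (¬R[α,α,x] (first pq⊑α) (second pq⊑α))
  cases (_ ∷ _ ∷ _ ∷ []) [] refl pqr⊑α _ = inj₁ (p , q , r , pqr , pqr⊑α)

<ᵇ-true : ∀ {m n} → m < n → (m <ᵇ n) ≡ true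
<ᵇ-true m<n = to T-≡ (<⇒<ᵇ m<n)

<ᵇ-true⁻ : ∀ {m n} → (m <ᵇ n) ≡ true → m < n
<ᵇ-true⁻ {m} {n} eq = <ᵇ⇒< m n (from T-≡ eq)

<ᵇ-false : ∀ {m n} → n ≤ m → (m <ᵇ n) ≡ false
<ᵇ-false {m} {n} n≤m with m <ᵇ n in eq
... | true = contradiction (<ᵇ-true⁻ eq) (≤⇒≯ n≤m)
... | false = refl

<ᵇ-false⁻ : ∀ {m n} → (m <ᵇ n) ≡ false → n ≤ m
<ᵇ-false⁻ eq = ≮⇒≥ (λ m<n → subst T eq (<⇒<ᵇ m<n))

below-mono : ∀ {x y} w → x ≤ y → below x w ≤ below y w
below-mono [] _ = z≤n
below-mono {x} {y} (z ∷ w) x≤y with z <ᵇ x in z<x | z <ᵇ y in z≮y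
... | true | true = s≤s (below-mono w x≤y)
... | true | false = contradiction (<-≤-trans (<ᵇ-true⁻ z<x) x≤y) (≤⇒≯ (<ᵇ-false⁻ z≮y))
... | false | true = m≤n⇒m≤1+n (below-mono w x≤y)
... | false | false = below-mono w x≤y

below-reflects-< : ∀ {x y} w → below x w < below y w → x < y
below-reflects-< w bx<by = ≰⇒> (λ y≤x → <⇒≱ bx<by (below-mono w y≤x))

module _ {p q r : ℕ} where

  private
    s : List ℕ
    s = p ∷ q ∷ r ∷ []

    ranks : ∀ {i j k} → standardize s ≡ suc i ∷ suc j ∷ suc k ∷ [] →
      below p s ≡ i × below q s ≡ j × below r s ≡ k
    ranks eq = suc-injective (∷-injectiveˡ eq)
             , suc-injective (∷-injectiveˡ (∷-injectiveʳ eq))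
             , suc-injective (∷-injectiveˡ (∷-injectiveʳ (∷-injectiveʳ eq)))

  standardize-312⁻ : standardize s ≡ 3 ∷ 1 ∷ 2 ∷ [] → q < r × r < p
  standardize-312⁻ eq with bp , bq , br ← ranks eq =
    below-reflects-< s (subst₂ _<_ (sym bq) (sym br) z<s) , below-reflects-< s (subst₂ _<_ (sym br) (sym bp) (s<s z<s))

  standardize-312⁺ : q < r → r < p → standardize s ≡ 3 ∷ 1 ∷ 2 ∷ []
  standardize-312⁺ q<r r<p
    rewrite <ᵇ-false (≤-refl {p}) | <ᵇ-true (<-trans q<r r<p) | <ᵇ-true r<p
          | <ᵇ-false (<⇒≤ (<-trans q<r r<p)) | <ᵇ-false (≤-refl {q}) | <ᵇ-false (<⇒≤ q<r)
          | <ᵇ-false (<⇒≤ r<p) | <ᵇ-true q<r | <ᵇ-false (≤-refl {r}) = refl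

  standardize-213⁻ : standardize s ≡ 2 ∷ 1 ∷ 3 ∷ [] → q < p × p < r
  standardize-213⁻ eq with bp , bq , br ← ranks eq =
    below-reflects-< s (subst₂ _<_ (sym bq) (sym bp) z<s) , below-reflects-< s (subst₂ _<_ (sym bp) (sym br) (s<s z<s))

  standardize-213⁺ : q < p → p < r → standardize s ≡ 2 ∷ 1 ∷ 3 ∷ []
  standardize-213⁺ q<p p<r
    rewrite <ᵇ-false (≤-refl {p}) | <ᵇ-true q<p | <ᵇ-false (<⇒≤ p<r)
          | <ᵇ-false (<⇒≤ q<p) | <ᵇ-false (≤-refl {q}) | <ᵇ-false (<⇒≤ (<-trans q<p p<r))
          | <ᵇ-true p<r | <ᵇ-true (<-trans q<p p<r) | <ᵇ-false (≤-refl {r}) = refl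

listEq⇒≡ : ∀ u v → T (listEq u v) → u ≡ v
listEq⇒≡ [] [] _ = refl
listEq⇒≡ (x ∷ u) (y ∷ v) eq with x≡ᵇy , u≈v ← to T-∧ eq = cong₂ _∷_ (≡ᵇ⇒≡ x y x≡ᵇy) (listEq⇒≡ u v u≈v)

listEq-refl : ∀ u → T (listEq u u)
listEq-refl [] = _
listEq-refl (x ∷ u) = from T-∧ (≡⇒≡ᵇ x x refl , listEq-refl u)

contains⇔Occurs : ∀ {a b c} (R : ℕ → ℕ → ℕ → Set) →
  (∀ {p q r} → standardize (p ∷ q ∷ r ∷ []) ≡ a ∷ b ∷ c ∷ [] → R p q r) →
  (∀ {p q r} → R p q r → standardize (p ∷ q ∷ r ∷ []) ≡ a ∷ b ∷ c ∷ []) →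
  ∀ w → T (contains w (a ∷ b ∷ c ∷ [])) ⇔ Occurs R w
contains⇔Occurs {a} {b} {c} R std⇒R R⇒std w = mk⇔ contains⇒occurs occurs⇒contains
  where
  σ = a ∷ b ∷ c ∷ []
  occurrence : ∀ s → s ⊑ w → standardize s ≡ σ → Occurs R w
  occurrence (p ∷ q ∷ r ∷ []) s⊑w std≡σ = p , q , r , std⇒R std≡σ , s⊑w
  occurrence [] _ ()
  occurrence (_ ∷ []) _ ()
  occurrence (_ ∷ _ ∷ []) _ ()
  occurrence (_ ∷ _ ∷ _ ∷ _ ∷ _) _ ()
  contains⇒occurs : T (contains w σ) → Occurs R w
  contains⇒occurs h with s , s∈ , s≈σ ← find (any⁻ _ (subwords w) h) =
    occurrence s (∈-subwords⁻ w s∈) (listEq⇒≡ (standardize s) σ s≈σ)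
  occurs⇒contains : Occurs R w → T (contains w σ)
  occurs⇒contains (p , q , r , pqr , s⊑w) = any⁺ _ (lose (∈-subwords⁺ s⊑w)
    (subst (λ t → T (listEq t σ)) (sym (R⇒std pqr)) (listEq-refl σ)))

rhoLen-++-∷ : ∀ {x y} u {v} → x ≤ y → rhoLen y (u ++ x ∷ v) ≡ rhoLen y u
rhoLen-++-∷ [] x≤y rewrite <ᵇ-false x≤y = refl
rhoLen-++-∷ {y = y} (z ∷ u) x≤y = cong (λ ρ → if y <ᵇ z then suc ρ else 0) (rhoLen-++-∷ u x≤y)

rhoLen-above : ∀ {x v} → All (x <_) v → rhoLen x v ≡ length v
rhoLen-above [] = refl
rhoLen-above (x<y ∷ x<v) rewrite <ᵇ-true x<y = cong suc (rhoLen-above x<v)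

isJacobi-++-∷ : ∀ {x} α {β} → All (x <_) α → All (x <_) β →
  isJacobi (α ++ x ∷ β) ≡ isJacobi α ∧ (evenᵇ (length β) ∧ isJacobi β)
isJacobi-++-∷ [] _ x<β = cong (λ ρ → evenᵇ ρ ∧ _) (rhoLen-above x<β)
isJacobi-++-∷ (y ∷ α) {β} (x<y ∷ x<α) x<β = begin
  evenᵇ (rhoLen y (α ++ _ ∷ β)) ∧ isJacobi (α ++ _ ∷ β)
    ≡⟨ cong₂ (λ ρ J → evenᵇ ρ ∧ J) (rhoLen-++-∷ α (<⇒≤ x<y)) (isJacobi-++-∷ α x<α x<β) ⟩
  evenᵇ (rhoLen y α) ∧ (isJacobi α ∧ _)
    ≡⟨ ∧-assoc (evenᵇ (rhoLen y α)) _ _ ⟨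
  (evenᵇ (rhoLen y α) ∧ isJacobi α) ∧ _
    ∎
  where open ≡-Reasoning

-- Generating the good arrangements

summands<fuel : ∀ {k m n f} → k + m ≡ n → n < f → k < f × m < f
summands<fuel {k} {m} refl n<f = ≤-<-trans (m≤m+n k m) n<f , ≤-<-trans (m≤n+m m k) n<f

T-not⁺ : ∀ {b} → ¬ T b → T (not b)
T-not⁺ {true} ¬b = ¬b _
T-not⁺ {false} _ = _

T-not⁻ : ∀ {b} → T (not b) → ¬ T b
T-not⁻ {false} _ ()

-- A good arrangement with minimum lo is α ++ lo ∷ β, where, for the pattern at hand, α and β are
-- arrangements of intervals starting at lα and lβ (functions of lo and the block sizes);
-- join, split and noStraddle are the pattern-specific facts about these blocks.
module Generation
  (R : ℕ → ℕ → ℕ → Set)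
  (lα lβ : ℕ → ℕ → ℕ → ℕ)
  (lo<lα : ∀ {lo k m} → lo < lα lo k m)
  (lo<lβ : ∀ {lo k m} → lo < lβ lo k m)
  (join : ∀ {lo k m α β} → Arrangement (lα lo k m) k α → Arrangement (lβ lo k m) m β →
          Arrangement lo (suc (k + m)) (α ++ lo ∷ β))
  (split : ∀ {lo n} α {β} → Arrangement lo (suc n) (α ++ lo ∷ β) → ¬ Occurs R (α ++ lo ∷ β) →
           Arrangement (lα lo (length α) (length β)) (length α) α ×
           Arrangement (lβ lo (length α) (length β)) (length β) β)
  (noStraddle : ∀ {lo k m α β} → Arrangement (lα lo k m) k α → Arrangement (lβ lo k m) m β →
                Occurs R (α ++ lo ∷ β) → Occurs R α ⊎ Occurs R β)
  where

  Good : List ℕ → Set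
  Good w = T (isJacobi w) × ¬ Occurs R w

  isJacobi-join : ∀ {lo k m α β} → Arrangement (lα lo k m) k α → Arrangement (lβ lo k m) m β →
    isJacobi (α ++ lo ∷ β) ≡ isJacobi α ∧ (evenᵇ m ∧ isJacobi β)
  isJacobi-join {α = α} arrα arrβ = trans
    (isJacobi-++-∷ α (Arrangement-above lo<lα arrα) (Arrangement-above lo<lβ arrβ))
    (cong (λ m → isJacobi α ∧ (evenᵇ m ∧ _)) (length≡ arrβ))

  Good-join : ∀ {lo k m α β} → Arrangement (lα lo k m) k α → Arrangement (lβ lo k m) m β →
    Good α → Good β → T (evenᵇ m) → Good (α ++ lo ∷ β)
  Good-join arrα arrβ (jacα , avoidα) (jacβ , avoidβ) even-m =
    subst T (sym (isJacobi-join arrα arrβ)) (from T-∧ (jacα , from T-∧ (even-m , jacβ))) ,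
    [ avoidα , avoidβ ]′ ∘ noStraddle arrα arrβ

  Good-split : ∀ {lo k m α β} → Arrangement (lα lo k m) k α → Arrangement (lβ lo k m) m β →
    Good (α ++ lo ∷ β) → Good α × Good β × T (evenᵇ m)
  Good-split {lo} {α = α} {β} arrα arrβ (jac , avoid)
    with jacα , jac-loβ ← to T-∧ (subst T (isJacobi-join arrα arrβ) jac)
    with even-m , jacβ ← to T-∧ jac-loβ =
    (jacα , avoid ∘ Occurs-⊑ (++⁺ʳ (lo ∷ β) ⊆-refl)) , (jacβ , avoid ∘ Occurs-⊑ (++⁺ˡ α (lo ∷ʳ ⊆-refl))) , even-m

  -- The first argument is fuel: the lemmas below need the size n to be below it.
  goodArrangements : ℕ → ℕ → ℕ → List (List ℕ)
  joinings : ℕ → ℕ → ℕ × ℕ → List (List ℕ)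

  goodArrangements zero _ _ = []
  goodArrangements (suc f) lo zero = [] ∷ []
  goodArrangements (suc f) lo (suc n) = concatMap (joinings f lo) (evenSplits n)

  joinings f lo (k , m) = cartesianProductWith (λ α β → α ++ lo ∷ β)
    (goodArrangements f (lα lo k m) k) (goodArrangements f (lβ lo k m) m)

  ∈-joinings⁻ : ∀ f lo {k m w} → w ∈ joinings f lo (k , m) →
    ∃₂ λ α β → α ∈ goodArrangements f (lα lo k m) k × β ∈ goodArrangements f (lβ lo k m) m × w ≡ α ++ lo ∷ β
  ∈-joinings⁻ f lo {k} {m} =
    ∈-cartesianProductWith⁻ _ (goodArrangements f (lα lo k m) k) (goodArrangements f (lβ lo k m) m)

  ∈-goodArrangements⁻ : ∀ {f lo n w} → n < f → w ∈ goodArrangements f lo n → Arrangement lo n w × Good w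
  ∈-goodArrangements⁻ {suc f} {lo} {zero} _ (here refl) = Arrangement-[] lo , _ , λ ()
  ∈-goodArrangements⁻ {suc f} {lo} {suc n} (s≤s n<f) w∈
    with (k , m) , km∈ , w∈km ← find (∈-concatMap⁻ (joinings f lo) w∈)
    with α , β , α∈ , β∈ , refl ← ∈-joinings⁻ f lo w∈km
    with k+m≡n , even-m ← ∈-evenSplits⁻ n km∈
    with k<f , m<f ← summands<fuel k+m≡n n<f
    with arrα , goodα ← ∈-goodArrangements⁻ k<f α∈
    with arrβ , goodβ ← ∈-goodArrangements⁻ m<f β∈ =
    subst (λ N → Arrangement lo (suc N) (α ++ lo ∷ β)) k+m≡n (join arrα arrβ) , Good-join arrα arrβ goodα goodβ even-m

  ∈-goodArrangements⁺ : ∀ {f lo n w} → n < f → Arrangement lo n w → Good w → w ∈ goodArrangements f lo n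
  ∈-goodArrangements⁺ {suc f} {lo} {zero} _ arr _ rewrite Arrangement-0⇒≡[] arr = here refl
  ∈-goodArrangements⁺ {suc f} {lo} {suc n} (s≤s n<f) arr good
    with α , β , refl ← ∈-∃++ (Arrangement-min∈ arr)
    with arrα , arrβ ← split α arr (proj₂ good)
    with goodα , goodβ , even-β ← Good-split arrα arrβ good
    with |α|+|β|≡n ← trans (sym (length-++ α)) (suc-injective (trans (sym (length-++-∷ α)) (length≡ arr)))
    with k<f , m<f ← summands<fuel |α|+|β|≡n n<f =
    ∈-concatMap⁺ (joinings f lo) (lose
      (subst (λ N → (length α , length β) ∈ evenSplits N) |α|+|β|≡n (∈-evenSplits⁺ (length α) (length β) even-β))
      (∈-cartesianProductWith⁺ (λ α β → α ++ lo ∷ β)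
        (∈-goodArrangements⁺ k<f arrα goodα) (∈-goodArrangements⁺ m<f arrβ goodβ)))

  goodArrangements-unique : ∀ {f lo n} → n < f → Unique (goodArrangements f lo n)
  goodArrangements-unique {suc f} {lo} {zero} _ = [] ∷ []
  goodArrangements-unique {suc f} {lo} {suc n} (s≤s n<f) =
    Unique-concatMap⁺ (joinings f lo) (evenSplits-unique n) joinings-unique joinings-disjoint
    where
    arrangement : ∀ {l k α} → k < f → α ∈ goodArrangements f l k → Arrangement l k α
    arrangement k<f α∈ = proj₁ (∈-goodArrangements⁻ k<f α∈)
    lo∉ : ∀ {k m α} → k < f → α ∈ goodArrangements f (lα lo k m) k → lo ∉ α
    lo∉ k<f α∈ lo∈α = <-irrefl refl (lookup (Arrangement-above lo<lα (arrangement k<f α∈)) lo∈α)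
    joinings-unique : ∀ {km} → km ∈ evenSplits n → Unique (joinings f lo km)
    joinings-unique {k , m} km∈ with k<f , m<f ← summands<fuel (proj₁ (∈-evenSplits⁻ n km∈)) n<f =
      Unique-cartesianProductWith⁺ _ (goodArrangements-unique k<f) (goodArrangements-unique m<f)
        (λ α∈ α′∈ → ++-∷-cancel _ (lo∉ k<f α∈) (lo∉ k<f α′∈))
    joinings-disjoint : ∀ {km km′ w} → km ∈ evenSplits n → km′ ∈ evenSplits n →
      w ∈ joinings f lo km → w ∈ joinings f lo km′ → km ≡ km′
    joinings-disjoint {k , m} {k′ , m′} km∈ km′∈ w∈ w∈′
      with k<f , m<f ← summands<fuel (proj₁ (∈-evenSplits⁻ n km∈)) n<f
      with k′<f , m′<f ← summands<fuel (proj₁ (∈-evenSplits⁻ n km′∈)) n<f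
      with α , β , α∈ , β∈ , refl ← ∈-joinings⁻ f lo w∈
      with α′ , β′ , α′∈ , β′∈ , eq ← ∈-joinings⁻ f lo w∈′
      with refl , refl ← ++-∷-cancel α (lo∉ k<f α∈) (lo∉ k′<f α′∈) eq =
      cong₂ _,_ (trans (sym (length≡ (arrangement k<f α∈))) (length≡ (arrangement k′<f α′∈)))
                (trans (sym (length≡ (arrangement m<f β∈))) (length≡ (arrangement m′<f β′∈)))

  length-goodArrangements : ∀ {f lo n} → n < f → length (goodArrangements f lo n) ≡ jacobiCount n
  length-goodArrangements {suc f} {lo} {zero} _ = refl
  length-goodArrangements {suc f} {lo} {suc n} (s≤s n<f) = begin
    length (concatMap (joinings f lo) (evenSplits n))  ≡⟨ length-concatMap (joinings f lo) (evenSplits n) ⟩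
    sum (map (length ∘ joinings f lo) (evenSplits n))  ≡⟨ cong sum (map-cong-local (tabulate length-joinings)) ⟩
    splitSum jacobiCount jacobiCount n                 ≡⟨ jacobiCount-suc n ⟨
    jacobiCount (suc n)                                ∎
    where
    open ≡-Reasoning
    length-joinings : ∀ {km} → km ∈ evenSplits n →
      length (joinings f lo km) ≡ jacobiCount (proj₁ km) * jacobiCount (proj₂ km)
    length-joinings {k , m} km∈ with k<f , m<f ← summands<fuel (proj₁ (∈-evenSplits⁻ n km∈)) n<f =
      trans (length-cartesianProductWith _ (goodArrangements f (lα lo k m) k) (goodArrangements f (lβ lo k m) m))
            (cong₂ _*_ (length-goodArrangements k<f) (length-goodArrangements m<f))

  j≡jacobiCount : ∀ {a b c} → (∀ w → T (contains w (a ∷ b ∷ c ∷ [])) ⇔ Occurs R w) →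
    ∀ n → j (a ∷ b ∷ c ∷ []) n ≡ jacobiCount n
  j≡jacobiCount {a} {b} {c} contains⇔occurs n = trans
    (unique-⊆⊇⇒length≡ (Unique.filter⁺ good? (perms-unique n)) (goodArrangements-unique {lo = 1} {n = n} ≤-refl)
      good⇒arrangement arrangement⇒good)
    (length-goodArrangements {lo = 1} {n = n} ≤-refl)
    where
    σ = a ∷ b ∷ c ∷ []
    good? : (w : List ℕ) → Dec (good (σ ∷ []) w ≡ true)
    good? w = good (σ ∷ []) w Bool.≟ true
    good⇒arrangement : ∀ {w} → w ∈ filter good? (perms n) → w ∈ goodArrangements (suc n) 1 n
    good⇒arrangement {w} w∈
      with w∈perms , isGood ← ∈-filter⁻ good? {xs = perms n} w∈
      with jac , avoids ← to (T-∧ {isJacobi w}) (from T-≡ isGood) =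
      ∈-goodArrangements⁺ {n = n} ≤-refl (∈-perms⁻ w∈perms)
        (jac , T-not⁻ (proj₁ (to T-∧ avoids)) ∘ from (contains⇔occurs w))
    arrangement⇒good : ∀ {w} → w ∈ goodArrangements (suc n) 1 n → w ∈ filter good? (perms n)
    arrangement⇒good {w} w∈ with arr , jac , avoid ← ∈-goodArrangements⁻ {n = n} ≤-refl w∈ =
      ∈-filter⁺ good? (∈-perms⁺ arr)
        (to T-≡ (from T-∧ (jac , from T-∧ (T-not⁺ (avoid ∘ to (contains⇔occurs w)) , _))))

-- Jacobi permutations avoiding 312 and 213

module 312-avoiding where

  R : ℕ → ℕ → ℕ → Set
  R p q r = q < r × r < p

  join : ∀ {lo k m α β} → Arrangement (suc lo) k α → Arrangement (suc lo + k) m β →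
    Arrangement lo (suc (k + m)) (α ++ lo ∷ β)
  join {α = α} arrα arrβ = Arrangement-insertMin α (proj₁ (Arrangement-++⁺ arrα arrβ))

  split : ∀ {lo n} α {β} → Arrangement lo (suc n) (α ++ lo ∷ β) → ¬ Occurs R (α ++ lo ∷ β) →
    Arrangement (suc lo) (length α) α × Arrangement (suc lo + length α) (length β) β
  split {lo} α {β} arr avoid = Arrangement-++⁻ α parts α≺β
    where
    parts = Arrangement-removeMin α arr
    -- y ∈ α above z ∈ β would make y lo z an occurrence of 312.
    α≺β : α ≺ β
    α≺β {y} {z} y∈α z∈β with y <? z
    ... | yes y<z = y<z
    ... | no y≮z = contradiction (Occurs-++-∷⁺ α y∈α z∈β (lowerBound parts (∈-++⁺ʳ α z∈β) , z<y)) avoid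
      where z<y = ≤∧≢⇒< (≮⇒≥ y≮z) (Arrangement-++-distinct α parts y∈α z∈β ∘ sym)

  noStraddle : ∀ {lo k m α β} → Arrangement (suc lo) k α → Arrangement (suc lo + k) m β →
    Occurs R (α ++ lo ∷ β) → Occurs R α ⊎ Occurs R β
  noStraddle {lo} {α = α} {β} arrα arrβ = Occurs-++-∷⁻ α β
    (λ _ r∈β (_ , r<lo) → <-asym r<lo (lo<β r∈β))
    (λ p∈α r∈β (_ , r<p) → <-asym r<p (proj₂ (Arrangement-++⁺ arrα arrβ) p∈α r∈β))
    (λ _ q∈α (q<lo , _) → <-asym q<lo (lowerBound arrα q∈α))
    where
    lo<β : ∀ {z} → z ∈ β → lo < z
    lo<β z∈β = ≤-trans (m≤m+n (suc lo) _) (lowerBound arrβ z∈β)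

  open Generation R (λ lo _ _ → suc lo) (λ lo k _ → suc lo + k) ≤-refl (s≤s (m≤m+n _ _)) join split noStraddle
    public

module 213-avoiding where

  R : ℕ → ℕ → ℕ → Set
  R p q r = q < p × p < r

  join : ∀ {lo k m α β} → Arrangement (suc lo + m) k α → Arrangement (suc lo) m β →
    Arrangement lo (suc (k + m)) (α ++ lo ∷ β)
  join {lo} {k} {m} {α} {β} arrα arrβ = Arrangement-insertMin α
    (subst (λ N → Arrangement (suc lo) N (α ++ β)) (+-comm m k)
      (Arrangement-++-comm β (proj₁ (Arrangement-++⁺ arrβ arrα))))

  split : ∀ {lo n} α {β} → Arrangement lo (suc n) (α ++ lo ∷ β) → ¬ Occurs R (α ++ lo ∷ β) →
    Arrangement (suc lo + length β) (length α) α × Arrangement (suc lo) (length β) β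
  split {lo} α {β} arr avoid = swap (Arrangement-++⁻ β (Arrangement-++-comm α parts) β≺α)
    where
    parts = Arrangement-removeMin α arr
    -- y ∈ α below z ∈ β would make y lo z an occurrence of 213.
    β≺α : β ≺ α
    β≺α {z} {y} z∈β y∈α with z <? y
    ... | yes z<y = z<y
    ... | no z≮y = contradiction (Occurs-++-∷⁺ α y∈α z∈β (lowerBound parts (∈-++⁺ˡ y∈α) , y<z)) avoid
      where y<z = ≤∧≢⇒< (≮⇒≥ z≮y) (Arrangement-++-distinct α parts y∈α z∈β)

  noStraddle : ∀ {lo k m α β} → Arrangement (suc lo + m) k α → Arrangement (suc lo) m β →
    Occurs R (α ++ lo ∷ β) → Occurs R α ⊎ Occurs R β
  noStraddle {lo} {α = α} {β} arrα arrβ = Occurs-++-∷⁻ α β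
    (λ q∈β _ (q<lo , _) → <-asym q<lo (lowerBound arrβ q∈β))
    (λ p∈α r∈β (_ , p<r) → <-asym p<r (proj₂ (Arrangement-++⁺ arrβ arrα) r∈β p∈α))
    (λ p∈α _ (_ , p<lo) → <-asym p<lo (lo<α p∈α))
    where
    lo<α : ∀ {y} → y ∈ α → lo < y
    lo<α y∈α = ≤-trans (m≤m+n (suc lo) _) (lowerBound arrα y∈α)

  open Generation R (λ lo _ m → suc lo + m) (λ lo _ _ → suc lo) (s≤s (m≤m+n _ _)) ≤-refl join split noStraddle
    public

j312≡jacobiCount : ∀ n → j p312 n ≡ jacobiCount n
j312≡jacobiCount = 312-avoiding.j≡jacobiCount
  (contains⇔Occurs _ standardize-312⁻ (λ (q<r , r<p) → standardize-312⁺ q<r r<p))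

j213≡jacobiCount : ∀ n → j p213 n ≡ jacobiCount n
j213≡jacobiCount = 213-avoiding.j≡jacobiCount
  (contains⇔Occurs _ standardize-213⁻ (λ (q<p , p<r) → standardize-213⁺ q<p p<r))

module _ {σ} (jσ≡jacobiCount : ∀ n → j σ n ≡ jacobiCount n) (n : ℕ) where

  j-even : (2 * n + 1) * j σ (2 * n) ≡ (3 * n) C n
  j-even = trans (cong ((2 * n + 1) *_) (trans (jσ≡jacobiCount (2 * n)) (jacobiCount-even n)))
                 ([2n+1]*raney[n,1]≡[3n]Cn n)

  j-odd : (2 * n + 1) * j σ (2 * n + 1) ≡ (3 * n + 1) C (n + 1)
  j-odd = trans (cong ((2 * n + 1) *_) (trans (jσ≡jacobiCount (2 * n + 1)) (jacobiCount-odd n)))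
                ([2n+1]*raney[n,2]≡[3n+1]C[n+1] n)

theorem4p1 : (n : ℕ) →
    ((2 * n + 1) * j p213 (2 * n) ≡ (3 * n) C n)
    × ((2 * n + 1) * j p312 (2 * n) ≡ (3 * n) C n)
    × ((2 * n + 1) * j p213 (2 * n + 1) ≡ (3 * n + 1) C (n + 1))
    × ((2 * n + 1) * j p312 (2 * n + 1) ≡ (3 * n + 1) C (n + 1))
theorem4p1 n =
  j-even j213≡jacobiCount n , j-even j312≡jacobiCount n , j-odd j213≡jacobiCount n , j-odd j312≡jacobiCount n
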